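{- Let $G$ be a graph and $G_1,\ldots,G_k$ subgraphs of $G$ such that (i) $E(G_1),\ldots,E(G_k)$ are mutually disjoint; (ii) for each $i$, every maximal clique of $G_i$ is also a maximal clique of $G$; (iii) for each $i$, any maximal clique of $G$ belonging to $G_i$ and any maximal clique of $G$ not belonging to $G_i$ share at most one vertex. Then $p(G)\ge \sum_{i=1}^k p(G_i)$.
   Context: All graphs are finite and simple. For an acyclic digraph $D$, the phylogeny graph $P(D)$ has vertex set $V(D)$, with $uv$ an edge iff $(u,v)\in A(D)$ or $(v,u)\in A(D)$, or $u,v$ have a common out-neighbor in $D$. A phylogeny digraph for $G$ is an acyclic digraph $D$ such that $G$ is an induced subgraph of $P(D)$ and $D$ has no arcs from vertices of $V(D)\setminus V(G)$ to vertices of $V(G)$. The phylogeny number $p(G)$ is the minimum of $|V(D)\setminus V(G)|$ over all phylogeny digraphs $D$ for $G$. A clique of $G$ "belongs to" a subgraph $H$ if it is a clique of $H$. -}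

module Defs where

open import Data.Nat using (ℕ; _+_; _≤_)
open import Data.Fin using (Fin; _↑ˡ_; _↑ʳ_)
open import Data.Bool using (Bool; T)
open import Data.Product using (Σ; ∃; _×_; _,_)
open import Data.Sum using (_⊎_)
open import Data.List using (tabulate)
open import Data.Nat.ListAction using (sum)
open import Relation.Nullary using (¬_)
open import Relation.Binary.PropositionalEquality using (_≡_; _≢_)
open import Relation.Binary.Construct.Closure.Transitive using (TransClosure)
open import Level using (0ℓ)
open import Relation.Unary using (Pred; _⊆_)

record Graph (n : ℕ) : Set where
  field
    adj    : Fin n → Fin n → Bool
    sym    : ∀ u v → T (adj u v) → T (adj v u)
    irrefl : ∀ v → ¬ T (adj v v)

open Graph public

Adj : ∀ {n} → Graph n → Fin n → Fin n → Set
Adj G u v = T (adj G u v)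

Clique : ∀ {n} → Graph n → Pred (Fin n) 0ℓ → Set
Clique G K = (∃ λ v → K v) × (∀ u v → K u → K v → u ≢ v → Adj G u v)

MaximalClique : ∀ {n} → Graph n → Pred (Fin n) 0ℓ → Set₁
MaximalClique {n} G K =
  Clique G K × (∀ (L : Pred (Fin n) 0ℓ) → Clique G L → K ⊆ L → L ⊆ K)

record Subgraph {n : ℕ} (G : Graph n) : Set where
  field
    size    : ℕ
    graph   : Graph size
    emb     : Fin size → Fin n
    emb-inj : ∀ u v → emb u ≡ emb v → u ≡ v
    edge⊆   : ∀ u v → Adj graph u v → Adj G (emb u) (emb v)

open Subgraph public

image : ∀ {n} {G : Graph n} (H : Subgraph G) → Pred (Fin (size H)) 0ℓ → Pred (Fin n) 0ℓ
image H K x = ∃ λ u → K u × emb H u ≡ x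

-- A set K of vertices of G "belongs to" H if it is a clique of H,
-- i.e. K ⊆ V(H) and (the preimage of) K is a clique of H.
BelongsTo : ∀ {n} {G : Graph n} (H : Subgraph G) → Pred (Fin n) 0ℓ → Set
BelongsTo H K = (∀ x → K x → ∃ λ u → emb H u ≡ x) × Clique (graph H) (λ u → K (emb H u))

Digraph : ℕ → Set
Digraph N = Fin N → Fin N → Bool

Arc : ∀ {N} → Digraph N → Fin N → Fin N → Set
Arc D u v = T (D u v)

Acyclic : ∀ {N} → Digraph N → Set
Acyclic D = ∀ v → ¬ TransClosure (Arc D) v v

-- Adjacency in the phylogeny graph P(D) (for distinct u, v).
PAdj : ∀ {N} → Digraph N → Fin N → Fin N → Set
PAdj D u v = Arc D u v ⊎ Arc D v u ⊎ (∃ λ w → Arc D u w × Arc D v w)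

-- D is a phylogeny digraph for G with m extra vertices: V(D) = Fin (k + m),
-- where V(G) = Fin k is identified with the first k vertices (_↑ˡ m)
-- and the extra vertices are k ↑ʳ_.
PhylogenyDigraph : ∀ {k} → Graph k → (m : ℕ) → Digraph (k + m) → Set
PhylogenyDigraph {k} G m D =
  Acyclic D
  × (∀ u v → u ≢ v → (Adj G u v → PAdj D (u ↑ˡ m) (v ↑ˡ m))
                    × (PAdj D (u ↑ˡ m) (v ↑ˡ m) → Adj G u v))
  × (∀ (x : Fin m) (u : Fin k) → ¬ Arc D (k ↑ʳ x) (u ↑ˡ m))

HasPhylogenyDigraph : ∀ {k} → Graph k → ℕ → Set
HasPhylogenyDigraph G m = Σ (Digraph _) (PhylogenyDigraph G m)

IsPhylogenyNumber : ∀ {k} → Graph k → ℕ → Set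
IsPhylogenyNumber G p = HasPhylogenyDigraph G p × (∀ m → HasPhylogenyDigraph G m → p ≤ m)

∑ : ∀ {k} → (Fin k → ℕ) → ℕ
∑ f = sum (tabulate f)

module Submission where

-- Fix a phylogeny digraph D for G with p extra vertices.  For a
-- vertex w of D, the vertices of G in the closed in-neighbourhood N[w] of w
-- form a clique of G.  Hypotheses (ii) and (iii) force: if N[w] contains an
-- edge of G_i, then every maximal clique of G containing N[w] belongs to G_i,
-- so any two distinct vertices of N[w] span an edge of G_i.  Consequently
--   * by (i), an extra vertex of D lies below edges of at most one G_i;
--   * keeping the vertices of G_i, the extra vertices lying below an edge of
--     G_i, and those arcs of D between them that are compatible with G_i
--     yields a phylogeny digraph for G_i.
-- So p(G_i) is at most the number of extra vertices used by G_i, and these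
-- numbers add up to at most p.

open import Defs hiding (sym)
import Data.Nat.Properties as ℕ
open import Algebra.Properties.CommutativeSemigroup ℕ.+-commutativeSemigroup
  using (interchange)
open import Data.Bool using (Bool; true; false; T; _∨_; _∧_)
open import Data.Bool.Properties using (T-∨; T-∧)
open import Data.Empty using (⊥-elim)
open import Data.Fin using (Fin; zero; suc; _≟_; _↑ˡ_; _↑ʳ_; splitAt)
open import Data.Fin.Properties
  using (any?; suc-injective; ↑ˡ-injective; splitAt-↑ˡ; splitAt-↑ʳ; splitAt⁻¹-↑ˡ; splitAt⁻¹-↑ʳ)
open import Data.List using (List; []; _∷_; foldl; allFin)
open import Data.List.Membership.Propositional using (_∈_)
open import Data.List.Membership.Propositional.Properties using (∈-allFin)
open import Data.List.Relation.Unary.Any using (here; there)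
open import Data.Nat using (ℕ; zero; suc; _+_; _≤_; z≤n; s≤s)
open import Data.Nat.Properties using (≤-reflexive; +-mono-≤; module ≤-Reasoning)
open import Data.Product using (Σ; ∃; ∃₂; _×_; _,_; proj₁; proj₂)
open import Data.Sum using (_⊎_; inj₁; inj₂)
import Data.Sum as Sum
open import Function using (_∘_)
open import Function.Bundles using (Equivalence)
open import Level using (0ℓ)
open import Relation.Binary.Construct.Closure.Transitive using ([_])
import Relation.Binary.Construct.Closure.Transitive as Closure
open import Relation.Binary.PropositionalEquality
  using (_≡_; _≢_; refl; sym; trans; cong; cong₂; subst)
open import Relation.Nullary using (¬_; Dec; yes; no)
open import Relation.Nullary.Decidable
  using (isYes; T?; ¬?; _×-dec_; _⊎-dec_; toWitness; fromWitness; decidable-stable)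
open import Relation.Unary using (Pred; _⊆_; Decidable)

open Equivalence using (to; from)

∑-mono : ∀ {k} {f g : Fin k → ℕ} → (∀ i → f i ≤ g i) → ∑ f ≤ ∑ g
∑-mono {zero}  f≤g = z≤n
∑-mono {suc k} f≤g = +-mono-≤ (f≤g zero) (∑-mono (f≤g ∘ suc))

∑-+ : ∀ {k} (f g : Fin k → ℕ) → ∑ (λ i → f i + g i) ≡ ∑ f + ∑ g
∑-+ {zero}  f g = refl
∑-+ {suc k} f g =
  trans (cong (f zero + g zero +_) (∑-+ (f ∘ suc) (g ∘ suc)))
        (interchange (f zero) (g zero) (∑ (f ∘ suc)) (∑ (g ∘ suc)))

∑-zero : ∀ {k} (f : Fin k → ℕ) → (∀ i → f i ≡ 0) → ∑ f ≡ 0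
∑-zero {zero}  f f≡0 = refl
∑-zero {suc k} f f≡0 rewrite f≡0 zero = ∑-zero (f ∘ suc) (f≡0 ∘ suc)

𝟙 : Bool → ℕ
𝟙 true  = 1
𝟙 false = 0

∑-𝟙-atMostOne : ∀ {k} (b : Fin k → Bool) → (∀ i j → T (b i) → T (b j) → i ≡ j)
  → ∑ (𝟙 ∘ b) ≤ 1
∑-𝟙-atMostOne {zero}  b unique = z≤n
∑-𝟙-atMostOne {suc k} b unique with b zero in b₀
... | false = ∑-𝟙-atMostOne (b ∘ suc) (λ i j bi bj → suc-injective (unique _ _ bi bj))
... | true  = s≤s (≤-reflexive (∑-zero (𝟙 ∘ b ∘ suc) others-false))
  where
  others-false : ∀ i → 𝟙 (b (suc i)) ≡ 0
  others-false i with b (suc i) in bᵢ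
  ... | false = refl
  ... | true with unique (suc i) zero (subst T (sym bᵢ) _) (subst T (sym b₀) _)
  ...   | ()

count : ∀ {p} → (Fin p → Bool) → ℕ
count {zero}  Q = 0
count {suc p} Q = 𝟙 (Q zero) + count (Q ∘ suc)

∑-count-disjoint : ∀ {k p} (h : Fin k → Fin p → Bool)
  → (∀ z i j → T (h i z) → T (h j z) → i ≡ j)
  → ∑ (λ i → count (h i)) ≤ p
∑-count-disjoint {p = zero}  h disjoint = ≤-reflexive (∑-zero (λ i → count (h i)) (λ _ → refl))
∑-count-disjoint {p = suc p} h disjoint = begin
  ∑ (λ i → 𝟙 (h i zero) + count (h i ∘ suc))
    ≡⟨ ∑-+ (λ i → 𝟙 (h i zero)) (λ i → count (h i ∘ suc)) ⟩
  ∑ (λ i → 𝟙 (h i zero)) + ∑ (λ i → count (h i ∘ suc))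
    ≤⟨ +-mono-≤ (∑-𝟙-atMostOne (λ i → h i zero) (disjoint zero))
                (∑-count-disjoint (λ i → h i ∘ suc) (disjoint ∘ suc)) ⟩
  suc p ∎
  where open ≤-Reasoning

enum-cons : ∀ {p m} (b : Bool) → (Fin m → Fin p) → Fin (𝟙 b + m) → Fin (suc p)
enum-cons true  f zero    = zero
enum-cons true  f (suc x) = suc (f x)
enum-cons false f x       = suc (f x)

enum : ∀ {p} (Q : Fin p → Bool) → Fin (count Q) → Fin p
enum {suc p} Q = enum-cons (Q zero) (enum (Q ∘ suc))

enum-sound : ∀ {p} (Q : Fin p → Bool) x → T (Q (enum Q x))
enum-sound {suc p} Q x with Q zero in q₀
enum-sound {suc p} Q zero    | true  = subst T (sym q₀) _
enum-sound {suc p} Q (suc x) | true  = enum-sound (Q ∘ suc) x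
enum-sound {suc p} Q x       | false = enum-sound (Q ∘ suc) x

enum-complete : ∀ {p} (Q : Fin p → Bool) z → T (Q z) → ∃ λ x → enum Q x ≡ z
enum-complete {suc p} Q zero Qz with Q zero
... | true = zero , refl
enum-complete {suc p} Q (suc z) Qz with Q zero | enum-complete (Q ∘ suc) z Qz
... | true  | x , refl = suc x , refl
... | false | x , refl = x , refl

-- The
-- greedy algorithm scans all vertices once, adding a vertex whenever no
-- current member is non-adjacent to it; sets only grow, so a vertex that was
-- rejected stays rejected by a witness in the final set.

module Greedy {n : ℕ} (G : Graph n) where

  VSet : Set
  VSet = Fin n → Bool

  Pairwise : VSet → Set
  Pairwise K = ∀ x y → T (K x) → T (K y) → x ≢ y → Adj G x y

  Blocks : VSet → Fin n → Fin n → Set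
  Blocks K y z = T (K z) × z ≢ y × ¬ Adj G z y

  blocks? : ∀ K y → Decidable (Blocks K y)
  blocks? K y z = T? (K z) ×-dec ¬? (z ≟ y) ×-dec ¬? (T? (adj G z y))

  insert : VSet → Fin n → VSet
  insert K y x = K x ∨ isYes (x ≟ y)

  insert-⊇ : ∀ K y x → T (K x) → T (insert K y x)
  insert-⊇ K y x Kx = from T-∨ (inj₁ Kx)

  insert-∋ : ∀ K y → T (insert K y y)
  insert-∋ K y = from T-∨ (inj₂ (fromWitness {a? = y ≟ y} refl))

  insert-cases : ∀ K y x → T (insert K y x) → T (K x) ⊎ x ≡ y
  insert-cases K y x ins = Sum.map₂ (toWitness {a? = x ≟ y}) (to T-∨ ins)

  insert-pairwise : ∀ K y → Pairwise K → (∀ z → T (K z) → z ≢ y → Adj G z y)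
    → Pairwise (insert K y)
  insert-pairwise K y pw toY x x′ Kx Kx′ x≢x′
    with insert-cases K y x Kx | insert-cases K y x′ Kx′
  ... | inj₁ a    | inj₁ b    = pw x x′ a b x≢x′
  ... | inj₁ a    | inj₂ refl = toY x a x≢x′
  ... | inj₂ refl | inj₁ b    = Graph.sym G x′ y (toY x′ b (x≢x′ ∘ sym))
  ... | inj₂ refl | inj₂ refl = ⊥-elim (x≢x′ refl)

  step : VSet → Fin n → VSet
  step K y with any? (blocks? K y)
  ... | yes _ = K
  ... | no  _ = insert K y

  step-⊇ : ∀ K y x → T (K x) → T (step K y x)
  step-⊇ K y x Kx with any? (blocks? K y)
  ... | yes _ = Kx
  ... | no  _ = insert-⊇ K y x Kx

  step-pairwise : ∀ K y → Pairwise K → Pairwise (step K y)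
  step-pairwise K y pw with any? (blocks? K y)
  ... | yes _         = pw
  ... | no  unblocked = insert-pairwise K y pw toY
    where
    toY : ∀ z → T (K z) → z ≢ y → Adj G z y
    toY z Kz z≢y = decidable-stable (T? (adj G z y)) (λ ¬adj → unblocked (z , Kz , z≢y , ¬adj))

  step-settles : ∀ K y → T (step K y y) ⊎ ∃ (Blocks (step K y) y)
  step-settles K y with any? (blocks? K y)
  ... | yes blocked = inj₂ blocked
  ... | no  _       = inj₁ (insert-∋ K y)

  greedy : List (Fin n) → VSet → VSet
  greedy ys K = foldl step K ys

  greedy-⊇ : ∀ ys K x → T (K x) → T (greedy ys K x)
  greedy-⊇ []       K x Kx = Kx
  greedy-⊇ (y ∷ ys) K x Kx = greedy-⊇ ys (step K y) x (step-⊇ K y x Kx)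

  greedy-pairwise : ∀ ys K → Pairwise K → Pairwise (greedy ys K)
  greedy-pairwise []       K pw = pw
  greedy-pairwise (y ∷ ys) K pw = greedy-pairwise ys (step K y) (step-pairwise K y pw)

  greedy-settles : ∀ ys K y → y ∈ ys → T (greedy ys K y) ⊎ ∃ (Blocks (greedy ys K) y)
  greedy-settles (y ∷ ys) K .y (here refl) with step-settles K y
  ... | inj₁ y∈          = inj₁ (greedy-⊇ ys _ y y∈)
  ... | inj₂ (z , Kz , b) = inj₂ (z , greedy-⊇ ys _ z Kz , b)
  greedy-settles (_ ∷ ys) K y (there y∈ys) = greedy-settles ys _ y y∈ys

  maximal-extension : ∀ {C : Pred (Fin n) 0ℓ} → Decidable C → Clique G C
    → Σ (Pred (Fin n) 0ℓ) λ K → MaximalClique G K × C ⊆ K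
  maximal-extension {C} C? ((c , Cc) , C-pw) = K , (((c , C⊆K Cc) , K-pw) , K-max) , C⊆K
    where
    K₀ : VSet
    K₀ x = isYes (C? x)

    K : Pred (Fin n) 0ℓ
    K x = T (greedy (allFin n) K₀ x)

    C⊆K : C ⊆ K
    C⊆K {x} Cx = greedy-⊇ (allFin n) K₀ x (fromWitness Cx)

    K-pw : ∀ x y → K x → K y → x ≢ y → Adj G x y
    K-pw = greedy-pairwise (allFin n) K₀ (λ x y Kx Ky → C-pw x y (toWitness Kx) (toWitness Ky))

    K-max : ∀ L → Clique G L → K ⊆ L → L ⊆ K
    K-max L (_ , L-pw) K⊆L {y} Ly with greedy-settles (allFin n) K₀ y (∈-allFin y)
    ... | inj₁ Ky                    = Ky
    ... | inj₂ (z , Kz , z≢y , ¬adj) = ⊥-elim (¬adj (L-pw z y (K⊆L Kz) Ly z≢y))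

open Greedy using (maximal-extension)

EdgeOf : ∀ {n} {G : Graph n} (H : Subgraph G) → Fin n → Fin n → Set
EdgeOf H x y = ∃₂ λ t t′ → emb H t ≡ x × emb H t′ ≡ y × Adj (graph H) t t′

edgeOf? : ∀ {n} {G : Graph n} (H : Subgraph G) x y → Dec (EdgeOf H x y)
edgeOf? H x y = any? λ t → any? λ t′ →
  (emb H t ≟ x) ×-dec (emb H t′ ≟ y) ×-dec T? (adj (graph H) t t′)

emb-≢ : ∀ {n} {G : Graph n} (H : Subgraph G) {u v} → Adj (graph H) u v → emb H u ≢ emb H v
emb-≢ H {u} {v} uv eq with emb-inj H u v eq
... | refl = Graph.irrefl (graph H) u uv

edgeOf-emb : ∀ {n} {G : Graph n} (H : Subgraph G) {u v}
  → EdgeOf H (emb H u) (emb H v) → Adj (graph H) u v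
edgeOf-emb H {u} {v} (t , t′ , eu , ev , tt′)
  with emb-inj H t u eu | emb-inj H t′ v ev
... | refl | refl = tt′

edgeOf-from : ∀ {n} {G : Graph n} (H : Subgraph G) {u x}
  → EdgeOf H (emb H u) x → ∃ λ t → emb H t ≡ x × Adj (graph H) u t
edgeOf-from H {u} (t₀ , t , eu , ex , t₀t) with emb-inj H t₀ u eu
... | refl = t , ex , t₀t

image-belongs : ∀ {n} {G : Graph n} (H : Subgraph G) {M}
  → Clique (graph H) M → BelongsTo H (image H M)
image-belongs H {M} ((u , Mu) , M-pw) = covered , (u , u , Mu , refl) , pairwise
  where
  covered : ∀ x → image H M x → ∃ λ u → emb H u ≡ x
  covered x (u , _ , eu) = u , eu

  pairwise : ∀ t t′ → image H M (emb H t) → image H M (emb H t′) → t ≢ t′ → Adj (graph H) t t′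
  pairwise t t′ (s , Ms , es) (s′ , Ms′ , es′) t≢t′
    with emb-inj H s t es | emb-inj H s′ t′ es′
  ... | refl | refl = M-pw t t′ Ms Ms′ t≢t′

belongs-edge : ∀ {n} {G : Graph n} (H : Subgraph G) {K} → BelongsTo H K
  → ∀ {x y} → K x → K y → x ≢ y → EdgeOf H x y
belongs-edge H (covered , _ , K-pw) {x} {y} Kx Ky x≢y with covered x Kx | covered y Ky
... | t , refl | t′ , refl = t , t′ , refl , refl , K-pw t t′ Kx Ky (x≢y ∘ cong (emb H))

MaximalCliquesLift : ∀ {n} {G : Graph n} → Subgraph G → Set₁
MaximalCliquesLift {G = G} H =
  ∀ K → MaximalClique (graph H) K → MaximalClique G (image H K)

MeetInAtMostOne : ∀ {n} {G : Graph n} → Subgraph G → Set₁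
MeetInAtMostOne {n} {G} H = ∀ (K L : Pred (Fin n) 0ℓ)
  → MaximalClique G K → MaximalClique G L → BelongsTo H K → ¬ BelongsTo H L
  → ∀ x y → K x → L x → K y → L y → x ≡ y

EdgeDisjoint : ∀ {n} {G : Graph n} → Subgraph G → Subgraph G → Set
EdgeDisjoint H H′ = ∀ u v u′ v′ → Adj (graph H) u v → Adj (graph H′) u′ v′
  → ¬ (emb H u ≡ emb H′ u′ × emb H v ≡ emb H′ v′)

-- Under (ii) and (iii), a clique of G containing an edge of H consists of
-- edges of H: its maximal extension cannot fail to belong to H, since the
-- maximal clique of H through that edge is maximal in G and shares the two
-- ends of the edge with it.

module CliqueThroughEdge {n} {G : Graph n} (H : Subgraph G)
  (lifts : MaximalCliquesLift H) (meets : MeetInAtMostOne H) where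

  ends : Fin (size H) → Fin (size H) → Pred (Fin (size H)) 0ℓ
  ends u v t = t ≡ u ⊎ t ≡ v

  ends-clique : ∀ {u v} → Adj (graph H) u v → Clique (graph H) (ends u v)
  ends-clique {u} {v} uv = (u , inj₁ refl) , pairwise
    where
    pairwise : ∀ t t′ → ends u v t → ends u v t′ → t ≢ t′ → Adj (graph H) t t′
    pairwise _ _ (inj₁ refl) (inj₁ refl) t≢t′ = ⊥-elim (t≢t′ refl)
    pairwise _ _ (inj₁ refl) (inj₂ refl) _    = uv
    pairwise _ _ (inj₂ refl) (inj₁ refl) _    = Graph.sym (graph H) u v uv
    pairwise _ _ (inj₂ refl) (inj₂ refl) t≢t′ = ⊥-elim (t≢t′ refl)

  maximal-belongs : ∀ K → MaximalClique G K → ∀ {u v} → Adj (graph H) u v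
    → K (emb H u) → K (emb H v) → ¬ ¬ BelongsTo H K
  maximal-belongs K K-max {u} {v} uv Ku Kv K∉H
    with maximal-extension (graph H) (λ t → (t ≟ u) ⊎-dec (t ≟ v)) (ends-clique uv)
  ... | M , M-max , ends⊆M =
    emb-≢ H uv (meets (image H M) K (lifts M M-max) K-max (image-belongs H (proj₁ M-max)) K∉H
                      (emb H u) (emb H v) (u , ends⊆M (inj₁ refl) , refl) Ku
                                          (v , ends⊆M (inj₂ refl) , refl) Kv)

  -- Any two distinct vertices of a clique of G through an edge of H span an
  -- edge of H.  Belonging to H is not decidable, but having an edge is.
  clique-edges : ∀ {C} → Decidable C → Clique G C → ∀ {u v} → Adj (graph H) u v
    → C (emb H u) → C (emb H v) → ∀ x y → C x → C y → x ≢ y → EdgeOf H x y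
  clique-edges C? C-clique uv Cu Cv x y Cx Cy x≢y with maximal-extension G C? C-clique
  ... | K , K-max , C⊆K = decidable-stable (edgeOf? H x y) λ ¬xy →
    maximal-belongs K K-max uv (C⊆K Cu) (C⊆K Cv)
      (λ K∈H → ¬xy (belongs-edge H K∈H (C⊆K Cx) (C⊆K Cy) x≢y))

data Side (a b : ℕ) : Fin (a + b) → Set where
  left  : (x : Fin a) → Side a b (x ↑ˡ b)
  right : (y : Fin b) → Side a b (a ↑ʳ y)

side : ∀ a {b} (c : Fin (a + b)) → Side a b c
side a c with splitAt a c in eq
... | inj₁ x = subst (Side a _) (splitAt⁻¹-↑ˡ eq) (left x)
... | inj₂ y = subst (Side a _) (splitAt⁻¹-↑ʳ eq) (right y)

module Phylogeny {n p : ℕ} {G : Graph n} {D : Digraph (n + p)}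
  (isPhylogeny : PhylogenyDigraph G p D) where

  ι : Fin n → Fin (n + p)
  ι x = x ↑ˡ p

  acyclic : Acyclic D
  acyclic = proj₁ isPhylogeny

  adj⇒padj : ∀ x y → x ≢ y → Adj G x y → PAdj D (ι x) (ι y)
  adj⇒padj x y x≢y = proj₁ (proj₁ (proj₂ isPhylogeny) x y x≢y)

  padj⇒adj : ∀ x y → x ≢ y → PAdj D (ι x) (ι y) → Adj G x y
  padj⇒adj x y x≢y = proj₂ (proj₁ (proj₂ isPhylogeny) x y x≢y)

  InNbr : Fin (n + p) → Pred (Fin n) 0ℓ
  InNbr w x = Arc D (ι x) w ⊎ ι x ≡ w

  inNbr? : ∀ w → Decidable (InNbr w)
  inNbr? w x = T? (D (ι x) w) ⊎-dec (ι x ≟ w)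

  inNbr-pairwise : ∀ w x y → InNbr w x → InNbr w y → x ≢ y → Adj G x y
  inNbr-pairwise w x y Nx Ny x≢y = padj⇒adj x y x≢y (padj Nx Ny)
    where
    padj : InNbr w x → InNbr w y → PAdj D (ι x) (ι y)
    padj (inj₁ xw)   (inj₁ yw)   = inj₂ (inj₂ (w , xw , yw))
    padj (inj₁ xw)   (inj₂ refl) = inj₁ xw
    padj (inj₂ refl) (inj₁ yw)   = inj₂ (inj₁ yw)
    padj (inj₂ refl) (inj₂ ιy≡ιx) = ⊥-elim (x≢y (↑ˡ-injective p x y (sym ιy≡ιx)))

  EdgeBelow : Subgraph G → Fin (n + p) → Set
  EdgeBelow H w = ∃₂ λ u v → Adj (graph H) u v × InNbr w (emb H u) × InNbr w (emb H v)

  edgeBelow? : ∀ H w → Dec (EdgeBelow H w)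
  edgeBelow? H w = any? λ u → any? λ v →
    T? (adj (graph H) u v) ×-dec inNbr? w (emb H u) ×-dec inNbr? w (emb H v)

  below-edges : ∀ H → MaximalCliquesLift H → MeetInAtMostOne H → ∀ w → EdgeBelow H w
    → ∀ x y → InNbr w x → InNbr w y → x ≢ y → EdgeOf H x y
  below-edges H lifts meets w (u , v , uv , Nu , Nv) =
    CliqueThroughEdge.clique-edges H lifts meets
      (inNbr? w) ((emb H u , Nu) , inNbr-pairwise w) uv Nu Nv

  below-adj : ∀ H → MaximalCliquesLift H → MeetInAtMostOne H → ∀ w → EdgeBelow H w
    → ∀ u v → u ≢ v → Arc D (ι (emb H u)) w → Arc D (ι (emb H v)) w → Adj (graph H) u v
  below-adj H lifts meets w below u v u≢v uw vw =
    edgeOf-emb H (below-edges H lifts meets w below _ _ (inj₁ uw) (inj₁ vw) (u≢v ∘ emb-inj H u v))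

  usedBy : Subgraph G → Fin p → Bool
  usedBy H z = isYes (edgeBelow? H (n ↑ʳ z))

  used-once : ∀ H H′ → EdgeDisjoint H H′ → MaximalCliquesLift H → MeetInAtMostOne H
    → ∀ z → T (usedBy H z) → ¬ T (usedBy H′ z)
  used-once H H′ disjoint lifts meets z used used′
    with toWitness used′
  ... | u′ , v′ , u′v′ , Nu′ , Nv′
    with below-edges H lifts meets _ (toWitness used) _ _ Nu′ Nv′ (emb-≢ H′ u′v′)
  ... | t , t′ , tu′ , t′v′ , tt′ = disjoint t t′ u′ v′ tt′ u′v′ (tu′ , t′v′)

  module Restriction (H : Subgraph G)
    (lifts : MaximalCliquesLift H) (meets : MeetInAtMostOne H) where

    s : ℕ
    s = size H

    m : ℕ
    m = count (usedBy H)

    old : Fin s → Fin (n + p)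
    old u = ι (emb H u)

    new : Fin m → Fin (n + p)
    new x = n ↑ʳ enum (usedBy H) x

    lift : Fin s ⊎ Fin m → Fin (n + p)
    lift (inj₁ u) = old u
    lift (inj₂ x) = new x

    arcs : Fin s ⊎ Fin m → Fin s ⊎ Fin m → Bool
    arcs (inj₁ u) (inj₁ v) = D (old u) (old v) ∧ adj (graph H) u v
    arcs (inj₁ u) (inj₂ x) = D (old u) (new x)
    arcs (inj₂ _) _        = false

    D′ : Digraph (s + m)
    D′ a b = arcs (splitAt s a) (splitAt s b)

    D′-old-old : ∀ u v → D′ (u ↑ˡ m) (v ↑ˡ m) ≡ D (old u) (old v) ∧ adj (graph H) u v
    D′-old-old u v = cong₂ arcs (splitAt-↑ˡ s u m) (splitAt-↑ˡ s v m)

    D′-old-new : ∀ u x → D′ (u ↑ˡ m) (s ↑ʳ x) ≡ D (old u) (new x)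
    D′-old-new u x = cong₂ arcs (splitAt-↑ˡ s u m) (splitAt-↑ʳ s m x)

    D′-new : ∀ x c → D′ (s ↑ʳ x) c ≡ false
    D′-new x c = cong (λ α → arcs α (splitAt s c)) (splitAt-↑ʳ s m x)

    arc-old-old : ∀ u v → Arc D′ (u ↑ˡ m) (v ↑ˡ m) → Arc D (old u) (old v) × Adj (graph H) u v
    arc-old-old u v = to T-∧ ∘ subst T (D′-old-old u v)

    old-old-arc : ∀ u v → Arc D (old u) (old v) → Adj (graph H) u v → Arc D′ (u ↑ˡ m) (v ↑ˡ m)
    old-old-arc u v uv uv′ = subst T (sym (D′-old-old u v)) (from T-∧ (uv , uv′))

    arcs-sound : ∀ α β → T (arcs α β) → Arc D (lift α) (lift β)
    arcs-sound (inj₁ u) (inj₁ v) uv = proj₁ (to T-∧ uv)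
    arcs-sound (inj₁ u) (inj₂ x) ux = ux

    acyclic′ : Acyclic D′
    acyclic′ a cycle = acyclic (lift (splitAt s a))
      (to Closure.equivalent (Closure.map (λ {a} {b} → arcs-sound (splitAt s a) (splitAt s b))
                                          (from Closure.equivalent cycle)))

    no-arc-into-G : ∀ x u → ¬ Arc D′ (s ↑ʳ x) (u ↑ˡ m)
    no-arc-into-G x u = subst T (D′-new x (u ↑ˡ m))

    neighbour-below : ∀ u v → Adj (graph H) u v → ∀ x
      → Arc D (old u) (ι x) → Arc D (old v) (ι x) → ∃ λ t → emb H t ≡ x × Adj (graph H) u t
    neighbour-below u v uv x ux vx = edgeOf-from H
      (below-edges H lifts meets (ι x) (u , v , uv , inj₁ ux , inj₁ vx) _ x (inj₁ ux) (inj₂ refl) u≢x)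
      where
      u≢x : emb H u ≢ x
      u≢x refl = acyclic (ι x) [ ux ]

    common-forward : ∀ u v → Adj (graph H) u v → ∀ w → Arc D (old u) w → Arc D (old v) w
      → ∃ λ c → Arc D′ (u ↑ˡ m) c × Arc D′ (v ↑ˡ m) c
    common-forward u v uv w uw vw with side n w
    ... | left x
      with neighbour-below u v uv x uw vw | neighbour-below v u (Graph.sym (graph H) u v uv) x vw uw
    ...   | t , refl , ut | t′ , t′≡t , vt′ with emb-inj H t′ t t′≡t
    ...     | refl = t ↑ˡ m , old-old-arc u t uw ut , old-old-arc v t vw vt′
    common-forward u v uv w uw vw | right z
      with enum-complete (usedBy H) z (fromWitness (u , v , uv , inj₁ uw , inj₁ vw))
    ...   | x , refl = s ↑ʳ x , to-new u uw , to-new v vw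
      where
      to-new : ∀ t → Arc D (old t) (new x) → Arc D′ (t ↑ˡ m) (s ↑ʳ x)
      to-new t = subst T (sym (D′-old-new t x))

    common-backward : ∀ u v → u ≢ v → ∀ c → Arc D′ (u ↑ˡ m) c → Arc D′ (v ↑ˡ m) c
      → Adj (graph H) u v
    common-backward u v u≢v c uc vc with side s c
    ... | left t with arc-old-old u t uc | arc-old-old v t vc
    ...   | ut , ut′ | vt , _ =
      below-adj H lifts meets (old t) (u , t , ut′ , inj₁ ut , inj₂ refl) u v u≢v ut vt
    common-backward u v u≢v c uc vc | right x =
      below-adj H lifts meets (new x) (toWitness (enum-sound (usedBy H) x)) u v u≢v
        (subst T (D′-old-new u x) uc) (subst T (D′-old-new v x) vc)

    forward : ∀ u v → u ≢ v → Adj (graph H) u v → PAdj D′ (u ↑ˡ m) (v ↑ˡ m)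
    forward u v _ uv with adj⇒padj (emb H u) (emb H v) (emb-≢ H uv) (edge⊆ H u v uv)
    ... | inj₁ arc                = inj₁ (old-old-arc u v arc uv)
    ... | inj₂ (inj₁ arc)         = inj₂ (inj₁ (old-old-arc v u arc (Graph.sym (graph H) u v uv)))
    ... | inj₂ (inj₂ (w , uw , vw)) = inj₂ (inj₂ (common-forward u v uv w uw vw))

    backward : ∀ u v → u ≢ v → PAdj D′ (u ↑ˡ m) (v ↑ˡ m) → Adj (graph H) u v
    backward u v _   (inj₁ arc)                = proj₂ (arc-old-old u v arc)
    backward u v _   (inj₂ (inj₁ arc))         = Graph.sym (graph H) v u (proj₂ (arc-old-old v u arc))
    backward u v u≢v (inj₂ (inj₂ (c , uc , vc))) = common-backward u v u≢v c uc vc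

    restriction : PhylogenyDigraph (graph H) m D′
    restriction = acyclic′ , (λ u v u≢v → forward u v u≢v , backward u v u≢v) , no-arc-into-G

  restriction-bound : ∀ H → MaximalCliquesLift H → MeetInAtMostOne H
    → ∀ q → IsPhylogenyNumber (graph H) q → q ≤ count (usedBy H)
  restriction-bound H lifts meets q (_ , minimal) =
    minimal _ (Restriction.D′ H lifts meets , Restriction.restriction H lifts meets)

theorem5 : ∀ {n : ℕ} (G : Graph n) (k : ℕ) (Gs : Fin k → Subgraph G)
    → (∀ i j → i ≢ j → ∀ u v u′ v′ → Adj (graph (Gs i)) u v → Adj (graph (Gs j)) u′ v′
         → ¬ (emb (Gs i) u ≡ emb (Gs j) u′ × emb (Gs i) v ≡ emb (Gs j) v′))
    → (∀ i (K : Pred (Fin (size (Gs i))) 0ℓ) → MaximalClique (graph (Gs i)) K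
         → MaximalClique G (image (Gs i) K))
    → (∀ i (K L : Pred (Fin n) 0ℓ) → MaximalClique G K → MaximalClique G L
         → BelongsTo (Gs i) K → ¬ BelongsTo (Gs i) L
         → ∀ x y → K x → L x → K y → L y → x ≡ y)
    → ∀ (p : ℕ) (ps : Fin k → ℕ) → IsPhylogenyNumber G p
    → (∀ i → IsPhylogenyNumber (graph (Gs i)) (ps i))
    → ∑ ps ≤ p
theorem5 G k Gs disjoint lifts meets p ps ((D , isPhylogeny) , _) pᵢ = begin
  ∑ ps
    ≤⟨ ∑-mono (λ i → restriction-bound (Gs i) (lifts i) (meets i) (ps i) (pᵢ i)) ⟩
  ∑ (λ i → count (usedBy (Gs i)))
    ≤⟨ ∑-count-disjoint (λ i → usedBy (Gs i)) used-by-one ⟩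
  p ∎
  where
  open Phylogeny isPhylogeny
  open ≤-Reasoning

  used-by-one : ∀ z i j → T (usedBy (Gs i) z) → T (usedBy (Gs j) z) → i ≡ j
  used-by-one z i j usedᵢ usedⱼ with i ≟ j
  ... | yes i≡j = i≡j
  ... | no  i≢j =
    ⊥-elim (used-once (Gs i) (Gs j) (disjoint i j i≢j) (lifts i) (meets i) z usedᵢ usedⱼ)
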